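{- Let $\mathcal{V}$ be a symmetric monoidal closed category and $e:(A,\mu_A,\pi_A)\to(B,\mu_B,\pi_B)$ a bracketed magma homomorphism that is an epimorphism. If $(A,\mu_A,\pi_A)$ is associative, then so is $(B,\mu_B,\pi_B)$.
   Context: Fix an object $0$ of $\mathcal{V}$. A bracketed magma is a triple $(A,\mu_A,\pi_A)$ with $\mu_A:A\otimes A\to A$ and $\pi_A: A\otimes A\to 0$. It is associative if $\mu_A\circ(\mu_A\otimes A)=\mu_A\circ(A\otimes\mu_A)$ and $\pi_A\circ(\mu_A\otimes A)=\pi_A\circ(A\otimes\mu_A)$. A bracketed magma homomorphism $f:(A,\mu_A,\pi_A)\to(B,\mu_B,\pi_B)$ is a morphism $f:A\to B$ with $f\circ\mu_A=\mu_B\circ(f\otimes f)$ and $\pi_A=\pi_B\circ(f\otimes f)$. -}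

module Defs where

open import Level using (Level; _⊔_) renaming (suc to lsuc)
open import Relation.Binary using (IsEquivalence)

record Category (o ℓ e : Level) : Set (lsuc (o ⊔ ℓ ⊔ e)) where
  infix  4 _≈_
  infixr 9 _∘_
  field
    Obj  : Set o
    _⇒_  : Obj → Obj → Set ℓ
    _≈_  : ∀ {A B} → A ⇒ B → A ⇒ B → Set e
    id   : ∀ {A} → A ⇒ A
    _∘_  : ∀ {A B C} → B ⇒ C → A ⇒ B → A ⇒ C
    ≈-equiv   : ∀ {A B} → IsEquivalence (_≈_ {A} {B})
    ∘-resp-≈  : ∀ {A B C} {f h : B ⇒ C} {g i : A ⇒ B} → f ≈ h → g ≈ i → f ∘ g ≈ h ∘ i
    assoc     : ∀ {A B C D} {f : A ⇒ B} {g : B ⇒ C} {h : C ⇒ D} → (h ∘ g) ∘ f ≈ h ∘ (g ∘ f)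
    identityˡ : ∀ {A B} {f : A ⇒ B} → id ∘ f ≈ f
    identityʳ : ∀ {A B} {f : A ⇒ B} → f ∘ id ≈ f

  Epi : ∀ {A B} → A ⇒ B → Set (o ⊔ ℓ ⊔ e)
  Epi {A} {B} f = ∀ {C} (g h : B ⇒ C) → g ∘ f ≈ h ∘ f → g ≈ h

record SymmetricMonoidalClosedCategory (o ℓ e : Level) : Set (lsuc (o ⊔ ℓ ⊔ e)) where
  field
    C : Category o ℓ e
  open Category C public
  infixr 10 _⊗₀_ _⊗₁_
  field
    _⊗₀_ : Obj → Obj → Obj
    _⊗₁_ : ∀ {A B X Y} → A ⇒ B → X ⇒ Y → (A ⊗₀ X) ⇒ (B ⊗₀ Y)
    ⊗-identity : ∀ {A X} → (id {A} ⊗₁ id {X}) ≈ id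
    ⊗-homomorphism : ∀ {A B D X Y Z} {f : A ⇒ B} {g : B ⇒ D} {h : X ⇒ Y} {k : Y ⇒ Z} →
                     ((g ∘ f) ⊗₁ (k ∘ h)) ≈ (g ⊗₁ k) ∘ (f ⊗₁ h)
    ⊗-resp-≈ : ∀ {A B X Y} {f f′ : A ⇒ B} {g g′ : X ⇒ Y} → f ≈ f′ → g ≈ g′ → (f ⊗₁ g) ≈ (f′ ⊗₁ g′)
    unit : Obj
    λ⇒ : ∀ {X} → (unit ⊗₀ X) ⇒ X
    λ⇐ : ∀ {X} → X ⇒ (unit ⊗₀ X)
    λ-isoˡ : ∀ {X} → λ⇐ ∘ λ⇒ {X} ≈ id
    λ-isoʳ : ∀ {X} → λ⇒ ∘ λ⇐ {X} ≈ id
    λ-natural : ∀ {X Y} {f : X ⇒ Y} → f ∘ λ⇒ ≈ λ⇒ ∘ (id ⊗₁ f)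
    ρ⇒ : ∀ {X} → (X ⊗₀ unit) ⇒ X
    ρ⇐ : ∀ {X} → X ⇒ (X ⊗₀ unit)
    ρ-isoˡ : ∀ {X} → ρ⇐ ∘ ρ⇒ {X} ≈ id
    ρ-isoʳ : ∀ {X} → ρ⇒ ∘ ρ⇐ {X} ≈ id
    ρ-natural : ∀ {X Y} {f : X ⇒ Y} → f ∘ ρ⇒ ≈ ρ⇒ ∘ (f ⊗₁ id)
    α⇒ : ∀ {X Y Z} → ((X ⊗₀ Y) ⊗₀ Z) ⇒ (X ⊗₀ (Y ⊗₀ Z))
    α⇐ : ∀ {X Y Z} → (X ⊗₀ (Y ⊗₀ Z)) ⇒ ((X ⊗₀ Y) ⊗₀ Z)
    α-isoˡ : ∀ {X Y Z} → α⇐ ∘ α⇒ {X} {Y} {Z} ≈ id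
    α-isoʳ : ∀ {X Y Z} → α⇒ ∘ α⇐ {X} {Y} {Z} ≈ id
    α-natural : ∀ {X X′ Y Y′ Z Z′} {f : X ⇒ X′} {g : Y ⇒ Y′} {h : Z ⇒ Z′} →
                α⇒ ∘ ((f ⊗₁ g) ⊗₁ h) ≈ (f ⊗₁ (g ⊗₁ h)) ∘ α⇒
    triangle : ∀ {X Y} → (id {X} ⊗₁ λ⇒ {Y}) ∘ α⇒ ≈ (ρ⇒ ⊗₁ id)
    pentagon : ∀ {W X Y Z} →
               (id {W} ⊗₁ α⇒ {X} {Y} {Z}) ∘ α⇒ ∘ (α⇒ ⊗₁ id) ≈ α⇒ ∘ α⇒
    σ : ∀ {X Y} → (X ⊗₀ Y) ⇒ (Y ⊗₀ X)
    σ-natural : ∀ {X X′ Y Y′} {f : X ⇒ X′} {g : Y ⇒ Y′} → σ ∘ (f ⊗₁ g) ≈ (g ⊗₁ f) ∘ σ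
    σ-involutive : ∀ {X Y} → σ {Y} {X} ∘ σ {X} {Y} ≈ id
    hexagon : ∀ {X Y Z} →
              (id ⊗₁ σ {X} {Z}) ∘ α⇒ {Y} {X} {Z} ∘ (σ {X} {Y} ⊗₁ id) ≈ α⇒ ∘ σ ∘ α⇒
    [_,_] : Obj → Obj → Obj
    eval  : ∀ {B D} → ([ B , D ] ⊗₀ B) ⇒ D
    curry : ∀ {A B D} → (A ⊗₀ B) ⇒ D → A ⇒ [ B , D ]
    eval-curry : ∀ {A B D} {f : (A ⊗₀ B) ⇒ D} → eval ∘ (curry f ⊗₁ id) ≈ f
    curry-unique : ∀ {A B D} {f : (A ⊗₀ B) ⇒ D} {g : A ⇒ [ B , D ]} →
                   eval ∘ (g ⊗₁ id) ≈ f → g ≈ curry f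

module _ {o ℓ e} (V : SymmetricMonoidalClosedCategory o ℓ e) where
  open SymmetricMonoidalClosedCategory V

  record BracketedMagma (𝟘 : Obj) : Set (o ⊔ ℓ) where
    field
      Carrier : Obj
      μ : (Carrier ⊗₀ Carrier) ⇒ Carrier
      π : (Carrier ⊗₀ Carrier) ⇒ 𝟘

  record IsAssociative {𝟘 : Obj} (M : BracketedMagma 𝟘) : Set e where
    open BracketedMagma M
    field
      μ-assoc : μ ∘ (μ ⊗₁ id) ≈ μ ∘ (id ⊗₁ μ) ∘ α⇒
      π-assoc : π ∘ (μ ⊗₁ id) ≈ π ∘ (id ⊗₁ μ) ∘ α⇒

  record IsBracketedMagmaHom {𝟘 : Obj} (M N : BracketedMagma 𝟘)
         (f : BracketedMagma.Carrier M ⇒ BracketedMagma.Carrier N) : Set e where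
    private
      module M = BracketedMagma M
      module N = BracketedMagma N
    field
      preserves-μ : f ∘ M.μ ≈ N.μ ∘ (f ⊗₁ f)
      preserves-π : M.π ≈ N.π ∘ (f ⊗₁ f)

{-# OPTIONS --safe #-}
-- Each functor − ⊗ Z is a left adjoint, so it preserves epimorphisms, and by
-- symmetry so does Z ⊗ −; hence (e ⊗ e) ⊗ e is epi. Precomposing either
-- associativity equation of B with (e ⊗ e) ⊗ e and pushing e inwards through
-- the homomorphism laws and naturality of α yields the corresponding equation
-- of A, which holds; cancelling the epi gives the equation for B.
module Submission where

open import Relation.Binary using (Setoid)
import Relation.Binary.Reasoning.Setoid as SetoidReasoning
open import Defs

module CategoryProperties {o ℓ e} (C : Category o ℓ e) where
  open Category C

  hom-setoid : Obj → Obj → Setoid ℓ e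
  hom-setoid X Y = record { Carrier = X ⇒ Y ; _≈_ = _≈_ ; isEquivalence = ≈-equiv }

  module HomReasoning {X Y : Obj} where
    open Setoid (hom-setoid X Y) public using (refl; sym; trans)
    open SetoidReasoning (hom-setoid X Y) public

  open HomReasoning

  infixr 4 _⟩∘⟨_
  _⟩∘⟨_ : ∀ {X Y Z} {f h : Y ⇒ Z} {g i : X ⇒ Y} → f ≈ h → g ≈ i → f ∘ g ≈ h ∘ i
  _⟩∘⟨_ = ∘-resp-≈

  Epi-resp-≈ : ∀ {X Y} {f g : X ⇒ Y} → f ≈ g → Epi f → Epi g
  Epi-resp-≈ {f = f} {g} f≈g epi-f a b a∘g≈b∘g = epi-f a b (begin
    a ∘ f ≈⟨ refl ⟩∘⟨ f≈g ⟩
    a ∘ g ≈⟨ a∘g≈b∘g ⟩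
    b ∘ g ≈⟨ refl ⟩∘⟨ sym f≈g ⟩
    b ∘ f ∎)

  Epi-∘ : ∀ {X Y Z} {f : Y ⇒ Z} {g : X ⇒ Y} → Epi f → Epi g → Epi (f ∘ g)
  Epi-∘ {f = f} {g} epi-f epi-g a b eq = epi-f a b (epi-g (a ∘ f) (b ∘ f) (begin
    (a ∘ f) ∘ g ≈⟨ assoc ⟩
    a ∘ f ∘ g   ≈⟨ eq ⟩
    b ∘ f ∘ g   ≈⟨ sym assoc ⟩
    (b ∘ f) ∘ g ∎))

  split-Epi : ∀ {X Y} {f : X ⇒ Y} (s : Y ⇒ X) → f ∘ s ≈ id → Epi f
  split-Epi {f = f} s f∘s≈id a b a∘f≈b∘f = begin
    a           ≈⟨ sym identityʳ ⟩
    a ∘ id      ≈⟨ refl ⟩∘⟨ sym f∘s≈id ⟩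
    a ∘ f ∘ s   ≈⟨ sym assoc ⟩
    (a ∘ f) ∘ s ≈⟨ a∘f≈b∘f ⟩∘⟨ refl ⟩
    (b ∘ f) ∘ s ≈⟨ assoc ⟩
    b ∘ f ∘ s   ≈⟨ refl ⟩∘⟨ f∘s≈id ⟩
    b ∘ id      ≈⟨ identityʳ ⟩
    b           ∎

module MonoidalClosedProperties {o ℓ e} (V : SymmetricMonoidalClosedCategory o ℓ e) where
  open SymmetricMonoidalClosedCategory V
  open CategoryProperties C public
  open HomReasoning

  ⊗-∘-id : ∀ {X Y Y′ Z} {f : Y ⇒ Z} {g : X ⇒ Y} → (f ∘ g) ⊗₁ id {Y′} ≈ (f ⊗₁ id) ∘ (g ⊗₁ id)
  ⊗-∘-id = trans (⊗-resp-≈ refl (sym identityˡ)) ⊗-homomorphism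

  curry-resp-≈ : ∀ {X Y Z} {g h : (X ⊗₀ Y) ⇒ Z} → g ≈ h → curry g ≈ curry h
  curry-resp-≈ g≈h = curry-unique (trans eval-curry g≈h)

  curry-∘ : ∀ {X Y Z W} (g : (Y ⊗₀ Z) ⇒ W) (f : X ⇒ Y) →
            curry g ∘ f ≈ curry (g ∘ (f ⊗₁ id))
  curry-∘ g f = curry-unique (begin
    eval ∘ ((curry g ∘ f) ⊗₁ id)          ≈⟨ refl ⟩∘⟨ ⊗-∘-id ⟩
    eval ∘ (curry g ⊗₁ id) ∘ (f ⊗₁ id)    ≈⟨ sym assoc ⟩
    (eval ∘ (curry g ⊗₁ id)) ∘ (f ⊗₁ id)  ≈⟨ eval-curry ⟩∘⟨ refl ⟩
    g ∘ (f ⊗₁ id)                          ∎)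

  Epi-⊗-id : ∀ {X Y Z} {f : X ⇒ Y} → Epi f → Epi (f ⊗₁ id {Z})
  Epi-⊗-id {f = f} epi-f g h g∘f⊗id≈h∘f⊗id = begin
    g                      ≈⟨ sym eval-curry ⟩
    eval ∘ (curry g ⊗₁ id) ≈⟨ refl ⟩∘⟨ ⊗-resp-≈ curry-g≈curry-h refl ⟩
    eval ∘ (curry h ⊗₁ id) ≈⟨ eval-curry ⟩
    h                      ∎
    where
      curry-g≈curry-h : curry g ≈ curry h
      curry-g≈curry-h = epi-f (curry g) (curry h) (begin
        curry g ∘ f               ≈⟨ curry-∘ g f ⟩
        curry (g ∘ (f ⊗₁ id))     ≈⟨ curry-resp-≈ g∘f⊗id≈h∘f⊗id ⟩
        curry (h ∘ (f ⊗₁ id))     ≈⟨ sym (curry-∘ h f) ⟩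
        curry h ∘ f               ∎)

  σ-conjugate : ∀ {X Y Z} {f : X ⇒ Y} → σ ∘ (f ⊗₁ id {Z}) ∘ σ ≈ id ⊗₁ f
  σ-conjugate {f = f} = begin
    σ ∘ (f ⊗₁ id) ∘ σ   ≈⟨ sym assoc ⟩
    (σ ∘ (f ⊗₁ id)) ∘ σ ≈⟨ σ-natural ⟩∘⟨ refl ⟩
    ((id ⊗₁ f) ∘ σ) ∘ σ ≈⟨ assoc ⟩
    (id ⊗₁ f) ∘ σ ∘ σ   ≈⟨ refl ⟩∘⟨ σ-involutive ⟩
    (id ⊗₁ f) ∘ id      ≈⟨ identityʳ ⟩
    id ⊗₁ f             ∎

  Epi-σ : ∀ {X Y} → Epi (σ {X} {Y})
  Epi-σ = split-Epi σ σ-involutive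

  Epi-id-⊗ : ∀ {X Y Z} {f : X ⇒ Y} → Epi f → Epi (id {Z} ⊗₁ f)
  Epi-id-⊗ epi-f = Epi-resp-≈ σ-conjugate (Epi-∘ Epi-σ (Epi-∘ (Epi-⊗-id epi-f) Epi-σ))

  ⊗-as-∘ : ∀ {X Y X′ Y′} {f : X ⇒ Y} {g : X′ ⇒ Y′} → (f ⊗₁ id) ∘ (id ⊗₁ g) ≈ f ⊗₁ g
  ⊗-as-∘ = trans (sym ⊗-homomorphism) (⊗-resp-≈ identityʳ identityˡ)

  Epi-⊗ : ∀ {X Y X′ Y′} {f : X ⇒ Y} {g : X′ ⇒ Y′} → Epi f → Epi g → Epi (f ⊗₁ g)
  Epi-⊗ epi-f epi-g = Epi-resp-≈ ⊗-as-∘ (Epi-∘ (Epi-⊗-id epi-f) (Epi-id-⊗ epi-g))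

module BracketedMagmaProperties {o ℓ e} (V : SymmetricMonoidalClosedCategory o ℓ e)
                                {𝟘 : SymmetricMonoidalClosedCategory.Obj V} where
  open SymmetricMonoidalClosedCategory V
  open MonoidalClosedProperties V
  open HomReasoning

  module _ (M : BracketedMagma V 𝟘) where
    open BracketedMagma M

    Associates : ∀ {W} → (Carrier ⊗₀ Carrier) ⇒ W → Set e
    Associates k = k ∘ (μ ⊗₁ id) ≈ k ∘ (id ⊗₁ μ) ∘ α⇒

    Associates-resp-≈ : ∀ {W} {k k′ : (Carrier ⊗₀ Carrier) ⇒ W} → k ≈ k′ → Associates k → Associates k′
    Associates-resp-≈ {k = k} {k′} k≈k′ assoc-k = begin
      k′ ∘ (μ ⊗₁ id)          ≈⟨ sym k≈k′ ⟩∘⟨ refl ⟩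
      k ∘ (μ ⊗₁ id)           ≈⟨ assoc-k ⟩
      k ∘ (id ⊗₁ μ) ∘ α⇒      ≈⟨ k≈k′ ⟩∘⟨ refl ⟩
      k′ ∘ (id ⊗₁ μ) ∘ α⇒     ∎

    Associates-∘ : ∀ {W W′} (g : W ⇒ W′) {k : (Carrier ⊗₀ Carrier) ⇒ W} → Associates k → Associates (g ∘ k)
    Associates-∘ g {k} assoc-k = begin
      (g ∘ k) ∘ (μ ⊗₁ id)      ≈⟨ assoc ⟩
      g ∘ k ∘ (μ ⊗₁ id)        ≈⟨ refl ⟩∘⟨ assoc-k ⟩
      g ∘ k ∘ (id ⊗₁ μ) ∘ α⇒   ≈⟨ sym assoc ⟩
      (g ∘ k) ∘ (id ⊗₁ μ) ∘ α⇒ ∎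

  module _ {A B : BracketedMagma V 𝟘} {f : BracketedMagma.Carrier A ⇒ BracketedMagma.Carrier B}
           (f-hom : IsBracketedMagmaHom V A B f) where
    private
      module A = BracketedMagma A
      module B = BracketedMagma B
    open IsBracketedMagmaHom f-hom

    μ-⊗-id-natural : (B.μ ⊗₁ id) ∘ ((f ⊗₁ f) ⊗₁ f) ≈ (f ⊗₁ f) ∘ (A.μ ⊗₁ id)
    μ-⊗-id-natural = begin
      (B.μ ⊗₁ id) ∘ ((f ⊗₁ f) ⊗₁ f) ≈⟨ sym ⊗-homomorphism ⟩
      (B.μ ∘ (f ⊗₁ f)) ⊗₁ (id ∘ f)  ≈⟨ ⊗-resp-≈ (sym preserves-μ) (trans identityˡ (sym identityʳ)) ⟩
      (f ∘ A.μ) ⊗₁ (f ∘ id)         ≈⟨ ⊗-homomorphism ⟩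
      (f ⊗₁ f) ∘ (A.μ ⊗₁ id)        ∎

    id-⊗-μ-natural : ((id ⊗₁ B.μ) ∘ α⇒) ∘ ((f ⊗₁ f) ⊗₁ f) ≈ (f ⊗₁ f) ∘ (id ⊗₁ A.μ) ∘ α⇒
    id-⊗-μ-natural = begin
      ((id ⊗₁ B.μ) ∘ α⇒) ∘ ((f ⊗₁ f) ⊗₁ f) ≈⟨ assoc ⟩
      (id ⊗₁ B.μ) ∘ α⇒ ∘ ((f ⊗₁ f) ⊗₁ f)   ≈⟨ refl ⟩∘⟨ α-natural ⟩
      (id ⊗₁ B.μ) ∘ (f ⊗₁ (f ⊗₁ f)) ∘ α⇒   ≈⟨ sym assoc ⟩
      ((id ⊗₁ B.μ) ∘ (f ⊗₁ (f ⊗₁ f))) ∘ α⇒ ≈⟨ sym ⊗-homomorphism ⟩∘⟨ refl ⟩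
      ((id ∘ f) ⊗₁ (B.μ ∘ (f ⊗₁ f))) ∘ α⇒  ≈⟨ ⊗-resp-≈ (trans identityˡ (sym identityʳ)) (sym preserves-μ) ⟩∘⟨ refl ⟩
      ((f ∘ id) ⊗₁ (f ∘ A.μ)) ∘ α⇒         ≈⟨ ⊗-homomorphism ⟩∘⟨ refl ⟩
      ((f ⊗₁ f) ∘ (id ⊗₁ A.μ)) ∘ α⇒        ≈⟨ assoc ⟩
      (f ⊗₁ f) ∘ (id ⊗₁ A.μ) ∘ α⇒          ∎

    Associates-reflect : Epi f → ∀ {W} (k : (B.Carrier ⊗₀ B.Carrier) ⇒ W) →
                         Associates A (k ∘ (f ⊗₁ f)) → Associates B k
    Associates-reflect epi-f k assoc-k∘f⊗f = Epi-⊗ (Epi-⊗ epi-f epi-f) epi-f _ _ (begin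
      (k ∘ (B.μ ⊗₁ id)) ∘ ((f ⊗₁ f) ⊗₁ f)        ≈⟨ assoc ⟩
      k ∘ (B.μ ⊗₁ id) ∘ ((f ⊗₁ f) ⊗₁ f)          ≈⟨ refl ⟩∘⟨ μ-⊗-id-natural ⟩
      k ∘ (f ⊗₁ f) ∘ (A.μ ⊗₁ id)                 ≈⟨ sym assoc ⟩
      (k ∘ (f ⊗₁ f)) ∘ (A.μ ⊗₁ id)               ≈⟨ assoc-k∘f⊗f ⟩
      (k ∘ (f ⊗₁ f)) ∘ (id ⊗₁ A.μ) ∘ α⇒          ≈⟨ assoc ⟩
      k ∘ (f ⊗₁ f) ∘ (id ⊗₁ A.μ) ∘ α⇒            ≈⟨ refl ⟩∘⟨ sym id-⊗-μ-natural ⟩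
      k ∘ ((id ⊗₁ B.μ) ∘ α⇒) ∘ ((f ⊗₁ f) ⊗₁ f)   ≈⟨ sym assoc ⟩
      (k ∘ (id ⊗₁ B.μ) ∘ α⇒) ∘ ((f ⊗₁ f) ⊗₁ f)   ∎)

mainTheorem8 : ∀ {o ℓ e} (V : SymmetricMonoidalClosedCategory o ℓ e)
    (𝟘 : SymmetricMonoidalClosedCategory.Obj V)
    (A B : BracketedMagma V 𝟘)
    (f : SymmetricMonoidalClosedCategory._⇒_ V (BracketedMagma.Carrier A) (BracketedMagma.Carrier B)) →
    IsBracketedMagmaHom V A B f →
    SymmetricMonoidalClosedCategory.Epi V f →
    IsAssociative V A →
    IsAssociative V B
mainTheorem8 V 𝟘 A B f f-hom epi-f A-assoc = record
  { μ-assoc = Associates-reflect f-hom epi-f B.μ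
                (Associates-resp-≈ A preserves-μ (Associates-∘ A f μ-assoc))
  ; π-assoc = Associates-reflect f-hom epi-f B.π (Associates-resp-≈ A preserves-π π-assoc)
  }
  where
    open BracketedMagmaProperties V
    module B = BracketedMagma B
    open IsBracketedMagmaHom f-hom
    open IsAssociative A-assoc
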